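{- Let $N\ge 1$ and $n\ge 1$ be integers. Then $$ CC_{N,n}=\Pi(n)\sum_{k=1}^{n}\binom{n+1}{k+1}\frac{(-1)^{N k}(-L_N)^k\,\Pi(k)}{\Pi(n+k r^N)}\left[ {n+k r^N}\atop{k}\right]_{C,\ge N}. $$
   Context: Let $r$ be a power of a prime, $T$ an indeterminate and $K=\mathbb F_r(T)$. For $i\ge 1$ put $[i]=T^{r^i}-T$, $D_i=[i][i-1]^r\cdots[1]^{r^{i-1}}$ and $L_i=[i][i-1]\cdots[1]$, with $D_0=L_0=1$. The Carlitz logarithm is $\log_C(x)=\sum_{i=0}^\infty(-1)^i x^{r^i}/L_i\in K[[x]]$, and its partial sums are $\mathcal F_m(x)=\sum_{i=0}^m(-1)^i x^{r^i}/L_i$ (with $\mathcal F_{ -1}=0$). For a non-negative integer $i$ with base-$r$ expansion $i=\sum_{j=0}^m c_j r^j$ ($0\le c_j<r$), the Carlitz factorial is $\Pi(i)=\prod_{j=0}^m D_j^{c_j}$. For $N\ge 1$, the truncated Cauchy-Carlitz numbers $CC_{N,n}$ are defined by $$ \frac{(-1)^N x^{r^N}/L_N}{\log_C(x)-\sum_{i=0}^{N-1}(-1)^i x^{r^i}/L_i}=\sum_{n=0}^\infty\frac{CC_{N,n}}{\Pi(n)}x^n . $$ The associated Stirling-Carlitz numbers of the first kind $\left[ {n}\atop{k}\right]_{C,\ge m}$ are defined by $$ \frac{\bigl(\log_C(z)-\mathcal F_{m-1}(z)\bigr)^k}{\Pi(k)}=\sum_{n=0}^\infty\left[ {n}\atop{k}\right]_{C,\ge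 m}\frac{z^n}{\Pi(n)} . $$ Binomial coefficients are ordinary integers viewed in $K$. -}

module Defs where

open import Level using (0ℓ)
open import Data.Nat as ℕ using (ℕ; zero; suc; _∸_; _≤ᵇ_; NonZero)
open import Data.Nat.DivMod using (_/_; _%_)
open import Data.Bool using (Bool; true; false; if_then_else_; _∧_)
open import Data.List using (List; []; _∷_)
open import Data.Fin using (Fin)
open import Data.Product using (∃)
open import Relation.Nullary using (¬_; does)
open import Relation.Binary.PropositionalEquality using (_≡_)
open import Algebra.Bundles using (CommutativeRing)
open import Algebra.Morphism.Structures using (module RingMorphisms)

-- Fields: a commutative ring with a total inverse map (0⁻¹ unspecified)

record Field : Set₁ where
  field
    commutativeRing : CommutativeRing 0ℓ 0ℓ
  open CommutativeRing commutativeRing public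
  field
    _⁻¹       : Carrier → Carrier
    ⁻¹-cong   : ∀ {x y} → x ≈ y → (x ⁻¹) ≈ (y ⁻¹)
    ⁻¹-inverse : ∀ x → ¬ (x ≈ 0#) → (x * (x ⁻¹)) ≈ 1#
    0≉1       : ¬ (0# ≈ 1#)

record HasCard (F : Field) (r : ℕ) : Set where
  open Field F
  field
    enum      : Fin r → Carrier
    enum-inj  : ∀ i j → enum i ≈ enum j → i ≡ j
    enum-surj : ∀ x → ∃ λ i → enum i ≈ x

record FieldEmbedding (F K : Field) : Set where
  module F = Field F
  module K = Field K
  open RingMorphisms F.rawRing K.rawRing using (IsRingHomomorphism)
  field
    ι          : F.Carrier → K.Carrier
    isRingHom  : IsRingHomomorphism ι
    injective  : ∀ x y → ι x K.≈ ι y → x F.≈ y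

module FieldOps (K : Field) where
  open Field K

  pow : Carrier → ℕ → Carrier
  pow x zero    = 1#
  pow x (suc n) = x * pow x n

  fromℕ : ℕ → Carrier
  fromℕ zero    = 0#
  fromℕ (suc n) = 1# + fromℕ n

  sgn : ℕ → Carrier
  sgn i = pow (- 1#) i

  sumTo : ℕ → (ℕ → Carrier) → Carrier
  sumTo zero    f = f 0
  sumTo (suc n) f = sumTo n f + f (suc n)

  sumFrom1 : ℕ → (ℕ → Carrier) → Carrier
  sumFrom1 zero    f = 0#
  sumFrom1 (suc n) f = sumFrom1 n f + f (suc n)

  Series : Set
  Series = ℕ → Carrier

  mulS : Series → Series → Series
  mulS f g n = sumTo n (λ i → f i * g (n ∸ i))

  oneS : Series
  oneS zero    = 1#
  oneS (suc _) = 0#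

  powS : Series → ℕ → Series
  powS f zero    = oneS
  powS f (suc k) = mulS f (powS f k)

  -- multiplicative inverse of a series c with c 0 ≠ 0:
  -- inv(0) = c₀⁻¹,  inv(n) = - c₀⁻¹ Σ_{j=1}^{n} c_j inv(n-j)
  invUpTo : Series → ℕ → Series
  invUpTo c zero    _ = c 0 ⁻¹
  invUpTo c (suc n) i =
    if i ≤ᵇ n then invUpTo c n i
    else - ((c 0 ⁻¹) * sumFrom1 (suc n) (λ j → c j * invUpTo c n (suc n ∸ j)))

  invS : Series → Series
  invS c n = invUpTo c n n

  shiftS : ℕ → Series → Series
  shiftS s f n = f (n ℕ.+ s)

  -- A / B for series A, B both divisible by x^s, with B / x^s having
  -- nonzero constant term:  (A/x^s) · (B/x^s)⁻¹
  divS : ℕ → Series → Series → Series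
  divS s A B = mulS (shiftS s A) (invS (shiftS s B))

-- Carlitz objects over K = F_r(T) (realised inside a field K with an
-- element T)

module Carlitz (K : Field) (r : ℕ) {{_ : NonZero r}} (T : Field.Carrier K) where
  open Field K
  open FieldOps K

  brk : ℕ → Carrier
  brk i = pow T (r ℕ.^ i) - T

  -- D_0 = 1, D_{i+1} = [i+1] D_i^r   (= [i+1][i]^r ⋯ [1]^{r^i})
  D : ℕ → Carrier
  D zero    = 1#
  D (suc i) = brk (suc i) * pow (D i) r

  L : ℕ → Carrier
  L zero    = 1#
  L (suc i) = brk (suc i) * L i

  -- Carlitz factorial: Π(n) = ∏_j D_j^{c_j}, n = Σ c_j r^j (base r digits)
  -- Πaux fuel j n = ∏_{t ≥ 0} D_{j+t}^{(t-th base-r digit of n)}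
  -- (fuel n suffices since n has at most n base-r digits when r ≥ 2)
  Πaux : ℕ → ℕ → ℕ → Carrier
  Πaux zero     j n = 1#
  Πaux (suc fu) j n = pow (D j) (n % r) * Πaux fu (suc j) (n / r)

  Πc : ℕ → Carrier
  Πc n = Πaux n 0 n

  -- coefficients of log_C(x) - F_{m-1}(x) = Σ_{i ≥ m} (-1)^i x^{r^i} / L_i
  -- (if r^i = n for some i, then i ≤ n)
  logTail : ℕ → Series
  logTail m n =
    sumTo n (λ i → if (m ≤ᵇ i) ∧ does (r ℕ.^ i ℕ.≟ n)
                   then sgn i * (L i ⁻¹) else 0#)

  -- Stirling–Carlitz numbers of the first kind [n k]_{C, ≥ m}:
  -- (log_C(z) - F_{m-1}(z))^k / Π(k) = Σ_n [n k]_{C,≥m} z^n / Π(n)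
  stirlingC : ℕ → ℕ → ℕ → Carrier
  stirlingC m n k = Πc n * ((Πc k ⁻¹) * powS (logTail m) k n)

  numer : ℕ → Series
  numer N n = if does (n ℕ.≟ r ℕ.^ N) then sgn N * (L N ⁻¹) else 0#

  -- truncated Cauchy–Carlitz numbers:
  -- numer_N(x) / (log_C(x) - F_{N-1}(x)) = Σ_n CC_{N,n} x^n / Π(n)
  -- both numerator and denominator are divisible by x^{r^N}
  CC : ℕ → ℕ → Carrier
  CC N n = Πc n * divS (r ℕ.^ N) (numer N) (logTail N) n

  -- T is transcendental over the image of F under ι:
  -- no nonzero polynomial over F vanishes at T
  module _ (F : Field) (ι : Field.Carrier F → Carrier) where
    private module F = Field F
    evalPoly : List F.Carrier → Carrier
    evalPoly []       = 0#
    evalPoly (c ∷ cs) = ι c + T * evalPoly cs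

{-# OPTIONS --safe #-}
-- Write s = r^N.  Numerator and denominator are both divisible by x^s, and dividing
-- by the lowest term (-1)^N x^s / L_N of the denominator turns the quotient into 1/u
-- for a series u with u(0) = 1.  For such u the polynomial
-- h_n = Σ_{k ≤ n} C(n+1,k+1) (-u)^k satisfies u h_n = 1 - (1 - u)^{n+1} ≡ 1 mod x^{n+1},
-- so h_n and 1/u agree in degree n, where the k = 0 term vanishes because n ≥ 1.
-- Finally [x^n] u^k = ((-1)^N L_N)^k [x^{n + k s}] (log_C - F_{N-1})^k, and the latter
-- coefficient is Π(k)/Π(n + k s) times the Stirling–Carlitz number.
-- The transcendence of T and r > 1 are used only to see that the brackets [i], hence
-- L_i, D_i and Π(n), are nonzero.
module Submission where

open import Defs
open import Data.Nat as ℕ using (ℕ; zero; suc; _≤_; _<_; _∸_; _≤ᵇ_; z≤n; s≤s; NonZero)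
import Data.Nat.Properties as ℕₚ
open import Data.Nat.Combinatorics using (_C_; nCk+nC[k+1]≡[n+1]C[k+1])
open import Data.Nat.Primality using (Prime; prime⇒nonTrivial)
open import Data.Bool using (true; false; if_then_else_; _∧_)
open import Data.Empty using (⊥-elim)
open import Data.List using ([]; _∷_; _++_; replicate)
open import Data.List.Relation.Unary.All using (All; _∷_)
open import Data.Product using (∃₂; _×_; _,_)
open import Data.Sum using (inj₁; inj₂)
open import Function using (_∘_)
open import Relation.Nullary using (¬_; yes; no; does; proof)
open import Relation.Nullary.Reflects using (ofʸ; ofⁿ)
open import Relation.Binary.PropositionalEquality as ≡ using (_≡_)
open import Algebra.Morphism.Structures using (module RingMorphisms)

1+n≤ᵇn : ∀ n → (suc n ≤ᵇ n) ≡ false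
1+n≤ᵇn zero    = ≡.refl
1+n≤ᵇn (suc n) = 1+n≤ᵇn n

1<p^[1+k] : ∀ {p} k → Prime p → 1 < p ℕ.^ suc k
1<p^[1+k] {p} k p-prime =
  ℕₚ.^-monoʳ-< p (ℕ.nonTrivial⇒n>1 p {{prime⇒nonTrivial p-prime}}) {0} {suc k} (s≤s z≤n)

nC[1+n]≡0 : ∀ n → n C suc n ≡ 0
nC[1+n]≡0 n rewrite 1+n≤ᵇn n = ≡.refl

module FieldLemmas (K : Field) where
  open Field K hiding (zero)
  open FieldOps K
  open import Relation.Binary.Reasoning.Setoid setoid
  open import Algebra.Properties.Ring ring using (-1*x≈-x; -‿distribˡ-*; -‿distribʳ-*)
  open import Algebra.Properties.Group +-group using (⁻¹-involutive)
  open import Algebra.Properties.CommutativeSemiring.Exp commutativeSemiring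
    using (_^_; ^-congˡ; ^-assocʳ; ^-distrib-*)
  open import Algebra.Properties.CommutativeSemigroup *-commutativeSemigroup
    using (x∙yz≈y∙xz)

  pow≡^ : ∀ x n → pow x n ≡ x ^ n
  pow≡^ x zero    = ≡.refl
  pow≡^ x (suc n) = ≡.cong (x *_) (pow≡^ x n)

  pow-cong : ∀ n {x y} → x ≈ y → pow x n ≈ pow y n
  pow-cong n {x} {y} x≈y rewrite pow≡^ x n | pow≡^ y n = ^-congˡ n x≈y

  pow-* : ∀ x y n → pow (x * y) n ≈ pow x n * pow y n
  pow-* x y n rewrite pow≡^ (x * y) n | pow≡^ x n | pow≡^ y n = ^-distrib-* x y n

  pow-pow : ∀ x m n → pow (pow x m) n ≈ pow x (m ℕ.* n)
  pow-pow x m n rewrite pow≡^ (pow x m) n | pow≡^ x m | pow≡^ x (m ℕ.* n) = ^-assocʳ x m n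

  pow-1# : ∀ n → pow 1# n ≈ 1#
  pow-1# zero    = refl
  pow-1# (suc n) = trans (*-identityˡ _) (pow-1# n)

  pow-neg : ∀ x n → pow (- x) n ≈ sgn n * pow x n
  pow-neg x n = trans (pow-cong n (sym (-1*x≈-x x))) (pow-* (- 1#) x n)

  sgn-square : ∀ n → sgn n * sgn n ≈ 1#
  sgn-square n = begin
    sgn n * sgn n        ≈⟨ pow-* (- 1#) (- 1#) n ⟨
    pow (- 1# * - 1#) n  ≈⟨ pow-cong n (trans (-1*x≈-x (- 1#)) (⁻¹-involutive 1#)) ⟩
    pow 1# n             ≈⟨ pow-1# n ⟩
    1#                   ∎

  -1*-inside : ∀ a s w → a * (- 1# * s * w) ≈ - (a * (s * w))
  -1*-inside a s w = begin
    a * (- 1# * s * w)  ≈⟨ *-congˡ (*-congʳ (-1*x≈-x s)) ⟩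
    a * (- s * w)       ≈⟨ *-congˡ (-‿distribˡ-* s w) ⟨
    a * - (s * w)       ≈⟨ -‿distribʳ-* a (s * w) ⟨
    - (a * (s * w))     ∎

  sgn-*-pow : ∀ m k x y → sgn k * (pow (sgn m * x) k * y) ≈ sgn (m ℕ.* k) * (pow (- x) k * y)
  sgn-*-pow m k x y = begin
    sgn k * (pow (sgn m * x) k * y)              ≈⟨ *-congˡ (*-congʳ (pow-* (sgn m) x k)) ⟩
    sgn k * (pow (sgn m) k * pow x k * y)        ≈⟨ *-congˡ (*-assoc _ _ _) ⟩
    sgn k * (pow (sgn m) k * (pow x k * y))      ≈⟨ x∙yz≈y∙xz _ _ _ ⟩
    pow (sgn m) k * (sgn k * (pow x k * y))      ≈⟨ *-cong (pow-pow (- 1#) m k) (sym (*-assoc _ _ _)) ⟩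
    sgn (m ℕ.* k) * (sgn k * pow x k * y)        ≈⟨ *-congˡ (*-congʳ (pow-neg x k)) ⟨
    sgn (m ℕ.* k) * (pow (- x) k * y)            ∎

  fromℕ-+ : ∀ m n → fromℕ (m ℕ.+ n) ≈ fromℕ m + fromℕ n
  fromℕ-+ zero    n = sym (+-identityˡ _)
  fromℕ-+ (suc m) n = trans (+-congˡ (fromℕ-+ m n)) (sym (+-assoc _ _ _))

  1≉0 : ¬ (1# ≈ 0#)
  1≉0 1≈0 = 0≉1 (sym 1≈0)

  ⁻¹-cancelˡ : ∀ {x} → ¬ (x ≈ 0#) → ∀ y → x ⁻¹ * (x * y) ≈ y
  ⁻¹-cancelˡ {x} x≉0 y = begin
    x ⁻¹ * (x * y)  ≈⟨ *-assoc _ _ _ ⟨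
    x ⁻¹ * x * y    ≈⟨ *-congʳ (trans (*-comm _ _) (⁻¹-inverse x x≉0)) ⟩
    1# * y          ≈⟨ *-identityˡ y ⟩
    y               ∎

  ⁻¹-cancelʳ : ∀ {x} → ¬ (x ≈ 0#) → ∀ y → x * (x ⁻¹ * y) ≈ y
  ⁻¹-cancelʳ {x} x≉0 y = trans (sym (*-assoc _ _ _)) (trans (*-congʳ (⁻¹-inverse x x≉0)) (*-identityˡ y))

  *-cancelˡ : ∀ {x y z} → ¬ (x ≈ 0#) → x * y ≈ x * z → y ≈ z
  *-cancelˡ {x} {y} {z} x≉0 xy≈xz = begin
    y               ≈⟨ ⁻¹-cancelˡ x≉0 y ⟨
    x ⁻¹ * (x * y)  ≈⟨ *-congˡ xy≈xz ⟩
    x ⁻¹ * (x * z)  ≈⟨ ⁻¹-cancelˡ x≉0 z ⟩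
    z               ∎

  *-nonzero : ∀ {x y} → ¬ (x ≈ 0#) → ¬ (y ≈ 0#) → ¬ (x * y ≈ 0#)
  *-nonzero x≉0 y≉0 xy≈0 = y≉0 (*-cancelˡ x≉0 (trans xy≈0 (sym (zeroʳ _))))

  pow-nonzero : ∀ {x} n → ¬ (x ≈ 0#) → ¬ (pow x n ≈ 0#)
  pow-nonzero zero    x≉0 = 1≉0
  pow-nonzero (suc n) x≉0 = *-nonzero x≉0 (pow-nonzero n x≉0)

  ⁻¹-nonzero : ∀ {x} → ¬ (x ≈ 0#) → ¬ (x ⁻¹ ≈ 0#)
  ⁻¹-nonzero {x} x≉0 x⁻¹≈0 = 1≉0 (trans (sym (⁻¹-inverse x x≉0)) (trans (*-congˡ x⁻¹≈0) (zeroʳ x)))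

  sgn-nonzero : ∀ n → ¬ (sgn n ≈ 0#)
  sgn-nonzero n s≈0 = 1≉0 (trans (sym (sgn-square n)) (trans (*-congʳ s≈0) (zeroˡ _)))

module FiniteSums (K : Field) where
  open Field K hiding (zero)
  open FieldOps K
  open import Relation.Binary.Reasoning.Setoid setoid
  open import Algebra.Properties.AbelianGroup +-abelianGroup using (⁻¹-∙-comm)
  open import Algebra.Properties.CommutativeSemigroup +-commutativeSemigroup
    using () renaming (interchange to +-interchange)

  sumTo-cong : ∀ n {f g : ℕ → Carrier} → (∀ i → i ≤ n → f i ≈ g i) → sumTo n f ≈ sumTo n g
  sumTo-cong zero    f≈g = f≈g 0 z≤n
  sumTo-cong (suc n) f≈g = +-cong (sumTo-cong n λ i i≤n → f≈g i (ℕₚ.m≤n⇒m≤1+n i≤n)) (f≈g (suc n) ℕₚ.≤-refl)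

  sumTo-zero : ∀ n {f : ℕ → Carrier} → (∀ i → i ≤ n → f i ≈ 0#) → sumTo n f ≈ 0#
  sumTo-zero zero    f≈0 = f≈0 0 z≤n
  sumTo-zero (suc n) f≈0 =
    trans (+-cong (sumTo-zero n λ i i≤n → f≈0 i (ℕₚ.m≤n⇒m≤1+n i≤n)) (f≈0 (suc n) ℕₚ.≤-refl)) (+-identityˡ 0#)

  sumTo-distrib-+ : ∀ n f g → sumTo n (λ i → f i + g i) ≈ sumTo n f + sumTo n g
  sumTo-distrib-+ zero    f g = refl
  sumTo-distrib-+ (suc n) f g = trans (+-congʳ (sumTo-distrib-+ n f g)) (+-interchange _ _ _ _)

  sumTo-neg : ∀ n f → sumTo n (λ i → - f i) ≈ - sumTo n f
  sumTo-neg zero    f = refl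
  sumTo-neg (suc n) f = trans (+-congʳ (sumTo-neg n f)) (⁻¹-∙-comm _ _)

  *-distribˡ-sumTo : ∀ n x f → x * sumTo n f ≈ sumTo n (λ i → x * f i)
  *-distribˡ-sumTo zero    x f = refl
  *-distribˡ-sumTo (suc n) x f = trans (distribˡ x _ _) (+-congʳ (*-distribˡ-sumTo n x f))

  sumTo-comm : ∀ m n (f : ℕ → ℕ → Carrier) →
    sumTo m (λ i → sumTo n (f i)) ≈ sumTo n (λ j → sumTo m (λ i → f i j))
  sumTo-comm zero    n f = refl
  sumTo-comm (suc m) n f =
    trans (+-congʳ (sumTo-comm m n f)) (sym (sumTo-distrib-+ n (λ j → sumTo m (λ i → f i j)) (f (suc m))))

  sumTo-head : ∀ n f → sumTo (suc n) f ≈ f 0 + sumTo n (λ i → f (suc i))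
  sumTo-head zero    f = refl
  sumTo-head (suc n) f = trans (+-congʳ (sumTo-head n f)) (+-assoc _ _ _)

  sumTo≈head+sumFrom1 : ∀ n f → sumTo n f ≈ f 0 + sumFrom1 n f
  sumTo≈head+sumFrom1 zero    f = sym (+-identityʳ _)
  sumTo≈head+sumFrom1 (suc n) f = trans (+-congʳ (sumTo≈head+sumFrom1 n f)) (+-assoc _ _ _)

  sumFrom1-cong : ∀ n {f g : ℕ → Carrier} → (∀ i → 1 ≤ i → i ≤ n → f i ≈ g i) → sumFrom1 n f ≈ sumFrom1 n g
  sumFrom1-cong zero    f≈g = refl
  sumFrom1-cong (suc n) f≈g =
    +-cong (sumFrom1-cong n λ i 1≤i i≤n → f≈g i 1≤i (ℕₚ.m≤n⇒m≤1+n i≤n)) (f≈g (suc n) (s≤s z≤n) ℕₚ.≤-refl)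

  sumFrom1-zero : ∀ n {f : ℕ → Carrier} → (∀ i → 1 ≤ i → i ≤ n → f i ≈ 0#) → sumFrom1 n f ≈ 0#
  sumFrom1-zero zero    f≈0 = refl
  sumFrom1-zero (suc n) f≈0 =
    trans (+-cong (sumFrom1-zero n λ i 1≤i i≤n → f≈0 i 1≤i (ℕₚ.m≤n⇒m≤1+n i≤n)) (f≈0 (suc n) (s≤s z≤n) ℕₚ.≤-refl))
          (+-identityˡ 0#)

  sumTo-single : ∀ n j f → j ≤ n → (∀ i → i ≤ n → ¬ (i ≡ j) → f i ≈ 0#) → sumTo n f ≈ f j
  sumTo-single zero    .zero f z≤n _ = refl
  sumTo-single (suc n) j    f j≤1+n f≈0 with ℕₚ.m≤n⇒m<n∨m≡n j≤1+n
  ... | inj₁ (s≤s j≤n) =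
    trans (+-cong (sumTo-single n j f j≤n λ i i≤n → f≈0 i (ℕₚ.m≤n⇒m≤1+n i≤n))
                  (f≈0 (suc n) ℕₚ.≤-refl λ 1+n≡j → ℕₚ.<-irrefl (≡.sym 1+n≡j) (s≤s j≤n)))
          (+-identityʳ _)
  ... | inj₂ ≡.refl =
    trans (+-congʳ (sumTo-zero n λ i i≤n → f≈0 i (ℕₚ.m≤n⇒m≤1+n i≤n) λ i≡1+n → ℕₚ.<-irrefl i≡1+n (s≤s i≤n)))
          (+-identityˡ _)

  sumTo-dropPrefix : ∀ s n f → (∀ i → i < s → f i ≈ 0#) → sumTo (s ℕ.+ n) f ≈ sumTo n (λ j → f (s ℕ.+ j))
  sumTo-dropPrefix zero    n f _   = refl
  sumTo-dropPrefix (suc s) n f f≈0 = begin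
    sumTo (suc (s ℕ.+ n)) f                         ≈⟨ sumTo-head (s ℕ.+ n) f ⟩
    f 0 + sumTo (s ℕ.+ n) (λ i → f (suc i))         ≈⟨ +-cong (f≈0 0 (s≤s z≤n))
                                                         (sumTo-dropPrefix s n _ λ i i<s → f≈0 (suc i) (s≤s i<s)) ⟩
    0# + sumTo n (λ j → f (suc (s ℕ.+ j)))          ≈⟨ +-identityˡ _ ⟩
    sumTo n (λ j → f (suc s ℕ.+ j))                 ∎

  sumTo-dropSuffix : ∀ t n f → (∀ i → n < i → i ≤ t ℕ.+ n → f i ≈ 0#) → sumTo (t ℕ.+ n) f ≈ sumTo n f
  sumTo-dropSuffix zero    n f _   = refl
  sumTo-dropSuffix (suc t) n f f≈0 =
    trans (+-cong (sumTo-dropSuffix t n f λ i n<i i≤t+n → f≈0 i n<i (ℕₚ.m≤n⇒m≤1+n i≤t+n))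
                  (f≈0 (suc (t ℕ.+ n)) (s≤s (ℕₚ.m≤n+m n t)) ℕₚ.≤-refl))
          (+-identityʳ _)

module PowerSeries (K : Field) where
  open Field K hiding (zero)
  open FieldOps K
  open FieldLemmas K
  open FiniteSums K
  open import Relation.Binary.Reasoning.Setoid setoid
  open import Algebra.Properties.Ring ring using (-‿distribʳ-*)
  open import Algebra.Properties.Group +-group using (∙-cancelʳ; x∙y⁻¹≈ε⇒x≈y)
  open import Algebra.Properties.CommutativeSemigroup *-commutativeSemigroup
    using (x∙yz≈y∙xz) renaming (interchange to *-interchange)
  open import Algebra.Properties.CommutativeSemigroup +-commutativeSemigroup
    using () renaming (x∙yz≈xz∙y to x+yz≈xz+y)

  mulS≈head+sumFrom1 : ∀ f g d → mulS f g d ≈ f 0 * g d + sumFrom1 d (λ i → f i * g (d ∸ i))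
  mulS≈head+sumFrom1 f g d = sumTo≈head+sumFrom1 d _

  mulS-congʳ : ∀ f {g h} d → (∀ e → e ≤ d → g e ≈ h e) → mulS f g d ≈ mulS f h d
  mulS-congʳ f d g≈h = sumTo-cong d λ i _ → *-congˡ (g≈h (d ∸ i) (ℕₚ.m∸n≤m d i))

  mulS-linearʳ : ∀ f n (a : ℕ → Carrier) (g : ℕ → Series) d →
    mulS f (λ e → sumTo n (λ k → a k * g k e)) d ≈ sumTo n (λ k → a k * mulS f (g k) d)
  mulS-linearʳ f n a g d = begin
    sumTo d (λ i → f i * sumTo n (λ k → a k * g k (d ∸ i)))
      ≈⟨ sumTo-cong d (λ i _ → *-distribˡ-sumTo n (f i) _) ⟩
    sumTo d (λ i → sumTo n (λ k → f i * (a k * g k (d ∸ i))))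
      ≈⟨ sumTo-cong d (λ i _ → sumTo-cong n λ k _ → x∙yz≈y∙xz _ _ _) ⟩
    sumTo d (λ i → sumTo n (λ k → a k * (f i * g k (d ∸ i))))
      ≈⟨ sumTo-comm d n _ ⟩
    sumTo n (λ k → sumTo d (λ i → a k * (f i * g k (d ∸ i))))
      ≈⟨ sumTo-cong n (λ k _ → *-distribˡ-sumTo d (a k) _) ⟨
    sumTo n (λ k → a k * mulS f (g k) d) ∎

  mulS-scalarʳ : ∀ f c g d → mulS f (λ e → c * g e) d ≈ c * mulS f g d
  mulS-scalarʳ f c g = mulS-linearʳ f 0 (λ _ → c) (λ _ → g)

  mulS-scalar : ∀ a f c g d → mulS (λ e → a * f e) (λ e → c * g e) d ≈ (a * c) * mulS f g d
  mulS-scalar a f c g d =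
    trans (sumTo-cong d λ i _ → *-interchange _ _ _ _) (sym (*-distribˡ-sumTo d (a * c) _))

  invUpTo-stable : ∀ c n i → i ≤ n → invUpTo c n i ≡ invS c i
  invUpTo-stable c zero    .zero z≤n  = ≡.refl
  invUpTo-stable c (suc n) i     i≤1+n with i ≤ᵇ n | ℕₚ.≤ᵇ-reflects-≤ i n
  ... | true  | ofʸ i≤n = invUpTo-stable c n i i≤n
  ... | false | ofⁿ i≰n with ℕₚ.m≤n⇒m<n∨m≡n i≤1+n
  ...   | inj₁ (s≤s i≤n) = ⊥-elim (i≰n i≤n)
  ...   | inj₂ ≡.refl rewrite 1+n≤ᵇn n = ≡.refl

  mulS-invS : ∀ c → ¬ (c 0 ≈ 0#) → ∀ d → mulS c (invS c) d ≈ oneS d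
  mulS-invS c c₀≉0 zero    = ⁻¹-inverse (c 0) c₀≉0
  mulS-invS c c₀≉0 (suc n) = begin
    mulS c (invS c) (suc n)
      ≈⟨ mulS≈head+sumFrom1 c (invS c) (suc n) ⟩
    c 0 * invS c (suc n) + sumFrom1 (suc n) (λ i → c i * invS c (suc n ∸ i))
      ≈⟨ +-cong (reflexive (≡.cong (c 0 *_) invS-suc))
                (sumFrom1-cong (suc n) λ { (suc i) _ _ →
                  reflexive (≡.cong (c (suc i) *_) (≡.sym (invUpTo-stable c n (n ∸ i) (ℕₚ.m∸n≤m n i)))) }) ⟩
    c 0 * - (c 0 ⁻¹ * S) + S
      ≈⟨ +-congʳ (-‿distribʳ-* (c 0) _) ⟨
    - (c 0 * (c 0 ⁻¹ * S)) + S
      ≈⟨ +-congʳ (-‿cong (⁻¹-cancelʳ c₀≉0 S)) ⟩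
    - S + S
      ≈⟨ -‿inverseˡ S ⟩
    0# ∎
    where
    S = sumFrom1 (suc n) (λ j → c j * invUpTo c n (suc n ∸ j))
    invS-suc : invS c (suc n) ≡ - (c 0 ⁻¹ * S)
    invS-suc rewrite 1+n≤ᵇn n = ≡.refl

  mulS-cancelˡ : ∀ u g h n → ¬ (u 0 ≈ 0#) → (∀ d → d ≤ n → mulS u g d ≈ mulS u h d) →
    ∀ d → d ≤ n → g d ≈ h d
  mulS-cancelˡ u g h n u₀≉0 ug≈uh d d≤n = agreeUpTo d d≤n d ℕₚ.≤-refl
    where
    next : ∀ d → d ≤ n → (∀ e → e < d → g e ≈ h e) → g d ≈ h d
    next d d≤n below = *-cancelˡ u₀≉0 (∙-cancelʳ _ _ _ (begin
      u 0 * g d + sumFrom1 d (λ i → u i * h (d ∸ i))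
        ≈⟨ +-congˡ (sumFrom1-cong d λ { (suc i) _ i≤d →
             *-congˡ (sym (below (d ∸ suc i) (ℕₚ.∸-monoʳ-< (s≤s z≤n) i≤d))) }) ⟩
      u 0 * g d + sumFrom1 d (λ i → u i * g (d ∸ i))   ≈⟨ mulS≈head+sumFrom1 u g d ⟨
      mulS u g d                                       ≈⟨ ug≈uh d d≤n ⟩
      mulS u h d                                       ≈⟨ mulS≈head+sumFrom1 u h d ⟩
      u 0 * h d + sumFrom1 d (λ i → u i * h (d ∸ i))   ∎))

    agreeUpTo : ∀ d → d ≤ n → ∀ e → e ≤ d → g e ≈ h e
    agreeUpTo zero    d≤n .zero z≤n = next 0 d≤n λ _ ()
    agreeUpTo (suc d) d≤n e     e≤1+d with ℕₚ.m≤n⇒m<n∨m≡n e≤1+d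
    ... | inj₁ (s≤s e≤d) = agreeUpTo d (ℕₚ.<⇒≤ d≤n) e e≤d
    ... | inj₂ ≡.refl    = next (suc d) d≤n λ e e<1+d → agreeUpTo d (ℕₚ.<⇒≤ d≤n) e (ℕₚ.≤-pred e<1+d)

  invS-scale : ∀ a c f → a * c ≈ 1# → ¬ (f 0 ≈ 0#) → ∀ d → invS (λ e → a * f e) d ≈ c * invS f d
  invS-scale a c f ac≈1 f₀≉0 d = mulS-cancelˡ af (invS af) (λ e → c * invS f e) d af₀≉0 (λ e _ → begin
      mulS af (invS af) e                     ≈⟨ mulS-invS af af₀≉0 e ⟩
      oneS e                                  ≈⟨ *-identityˡ _ ⟨
      1# * oneS e                             ≈⟨ *-cong ac≈1 (mulS-invS f f₀≉0 e) ⟨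
      (a * c) * mulS f (invS f) e             ≈⟨ mulS-scalar a f c (invS f) e ⟨
      mulS af (λ e → c * invS f e) e          ∎)
    d ℕₚ.≤-refl
    where
    af = λ e → a * f e
    a≉0 : ¬ (a ≈ 0#)
    a≉0 a≈0 = 1≉0 (trans (sym ac≈1) (trans (*-congʳ a≈0) (zeroˡ c)))
    af₀≉0 = *-nonzero a≉0 f₀≉0

  module _ (u : Series) where
    [1-u]^ : ℕ → Series
    [1-u]^ m d = sumTo m (λ j → fromℕ (m C j) * (sgn j * powS u j d))

    mulS-alternating : ∀ m (a : ℕ → Carrier) d →
      mulS u (λ e → sumTo m (λ j → a j * (sgn j * powS u j e))) d ≈ sumTo m (λ j → a j * (sgn j * powS u (suc j) d))
    mulS-alternating m a d = trans (mulS-linearʳ u m a (λ j e → sgn j * powS u j e) d)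
                                   (sumTo-cong m λ j _ → *-congˡ (mulS-scalarʳ u (sgn j) (powS u j) d))

    [1-u]^-suc : ∀ m d → [1-u]^ (suc m) d ≈ [1-u]^ m d - mulS u ([1-u]^ m) d
    [1-u]^-suc m d = begin
      [1-u]^ (suc m) d
        ≈⟨ sumTo-head m _ ⟩
      t₀ + sumTo m (λ j → fromℕ (suc m C suc j) * (sgn (suc j) * P (suc j)))
        ≈⟨ +-congˡ (sumTo-cong m λ j _ → pascal j) ⟩
      t₀ + sumTo m (λ j → - A j + B j)
        ≈⟨ +-congˡ (trans (sumTo-distrib-+ m _ _) (+-congʳ (sumTo-neg m A))) ⟩
      t₀ + (- sumTo m A + sumTo m B)
        ≈⟨ x+yz≈xz+y _ _ _ ⟩
      (t₀ + sumTo m B) - sumTo m A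
        ≈⟨ +-cong dropLast (-‿cong (sym (mulS-alternating m (λ j → fromℕ (m C j)) d))) ⟩
      [1-u]^ m d - mulS u ([1-u]^ m) d ∎
      where
      P = λ j → powS u j d
      t₀ = fromℕ (suc m C 0) * (sgn 0 * P 0)
      A B : ℕ → Carrier
      A j = fromℕ (m C j) * (sgn j * P (suc j))
      B j = fromℕ (m C suc j) * (sgn (suc j) * P (suc j))

      pascal : ∀ j → fromℕ (suc m C suc j) * (sgn (suc j) * P (suc j)) ≈ - A j + B j
      pascal j = begin
        fromℕ (suc m C suc j) * (sgn (suc j) * P (suc j))
          ≡⟨ ≡.cong (λ c → fromℕ c * (sgn (suc j) * P (suc j))) (nCk+nC[k+1]≡[n+1]C[k+1] m j) ⟨
        fromℕ (m C j ℕ.+ m C suc j) * (sgn (suc j) * P (suc j))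
          ≈⟨ *-congʳ (fromℕ-+ (m C j) (m C suc j)) ⟩
        (fromℕ (m C j) + fromℕ (m C suc j)) * (sgn (suc j) * P (suc j))
          ≈⟨ distribʳ _ _ _ ⟩
        fromℕ (m C j) * (sgn (suc j) * P (suc j)) + B j
          ≈⟨ +-congʳ (-1*-inside _ _ _) ⟩
        - A j + B j ∎

      dropLast : t₀ + sumTo m B ≈ [1-u]^ m d
      dropLast = begin
        t₀ + sumTo m B                        ≈⟨ sumTo-head m _ ⟨
        [1-u]^ m d + fromℕ (m C suc m) * (sgn (suc m) * P (suc m))
          ≡⟨ ≡.cong (λ c → [1-u]^ m d + fromℕ c * (sgn (suc m) * P (suc m))) (nC[1+n]≡0 m) ⟩
        [1-u]^ m d + 0# * (sgn (suc m) * P (suc m)) ≈⟨ +-congˡ (zeroˡ _) ⟩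
        [1-u]^ m d + 0#                       ≈⟨ +-identityʳ _ ⟩
        [1-u]^ m d                            ∎

    [1-u]^-vanishes : u 0 ≈ 1# → ∀ m d → d < m → [1-u]^ m d ≈ 0#
    [1-u]^-vanishes u₀≈1 (suc m) d (s≤s d≤m) = begin
      [1-u]^ (suc m) d                         ≈⟨ [1-u]^-suc m d ⟩
      g d - mulS u g d                         ≈⟨ +-congˡ (-‿cong (mulS≈head+sumFrom1 u g d)) ⟩
      g d - (u 0 * g d + sumFrom1 d (λ i → u i * g (d ∸ i)))
        ≈⟨ +-congˡ (-‿cong (+-cong (trans (*-congʳ u₀≈1) (*-identityˡ _)) (sumFrom1-zero d λ { (suc i) _ i≤d →
             trans (*-congˡ ([1-u]^-vanishes u₀≈1 m (d ∸ suc i) (ℕₚ.<-≤-trans (ℕₚ.∸-monoʳ-< (s≤s z≤n) i≤d) d≤m)))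
                   (zeroʳ _) }))) ⟩
      g d - (g d + 0#)                         ≈⟨ +-congˡ (-‿cong (+-identityʳ _)) ⟩
      g d - g d                                ≈⟨ -‿inverseʳ _ ⟩
      0#                                       ∎
      where g = [1-u]^ m

    truncatedInverse : ℕ → Series
    truncatedInverse n d = sumTo n (λ k → fromℕ ((n ℕ.+ 1) C (k ℕ.+ 1)) * (sgn k * powS u k d))

    mulS-truncatedInverse : u 0 ≈ 1# → ∀ n d → d ≤ n → mulS u (truncatedInverse n) d ≈ oneS d
    mulS-truncatedInverse u₀≈1 n d d≤n = trans (mulS-alternating n _ d) (sym (x∙y⁻¹≈ε⇒x≈y _ _ (begin
      oneS d - sumTo n A
        ≈⟨ +-cong (sym t₀≈1) (sym (sumTo-neg n A)) ⟩
      t₀ + sumTo n (λ k → - A k)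
        ≈⟨ +-congˡ (sumTo-cong n λ k _ →
             sym (trans (-1*-inside _ _ _) (-‿cong (*-congʳ (reflexive (≡.cong fromℕ (binom≡ k))))))) ⟩
      t₀ + sumTo n (λ k → fromℕ (suc n C suc k) * (sgn (suc k) * powS u (suc k) d))
        ≈⟨ sumTo-head n _ ⟨
      [1-u]^ (suc n) d
        ≈⟨ [1-u]^-vanishes u₀≈1 (suc n) d (s≤s d≤n) ⟩
      0# ∎)))
      where
      A : ℕ → Carrier
      A k = fromℕ ((n ℕ.+ 1) C (k ℕ.+ 1)) * (sgn k * powS u (suc k) d)
      t₀ = fromℕ (suc n C 0) * (sgn 0 * powS u 0 d)
      t₀≈1 : t₀ ≈ oneS d
      t₀≈1 = trans (*-cong (+-identityʳ 1#) (*-identityˡ _)) (*-identityˡ _)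
      binom≡ : ∀ k → suc n C suc k ≡ (n ℕ.+ 1) C (k ℕ.+ 1)
      binom≡ k = ≡.cong₂ _C_ (ℕₚ.+-comm 1 n) (ℕₚ.+-comm 1 k)

    invS-coefficient : u 0 ≈ 1# → ∀ n → 1 ≤ n →
      invS u n ≈ sumFrom1 n (λ k → fromℕ ((n ℕ.+ 1) C (k ℕ.+ 1)) * (sgn k * powS u k n))
    invS-coefficient u₀≈1 n@(suc _) _ = begin
      invS u n
        ≈⟨ mulS-cancelˡ u (invS u) (truncatedInverse n) n u₀≉0
             (λ d d≤n → trans (mulS-invS u u₀≉0 d) (sym (mulS-truncatedInverse u₀≈1 n d d≤n))) n ℕₚ.≤-refl ⟩
      truncatedInverse n n
        ≈⟨ sumTo≈head+sumFrom1 n _ ⟩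
      fromℕ ((n ℕ.+ 1) C 1) * (sgn 0 * 0#) + sumFrom1 n _
        ≈⟨ +-congʳ (trans (*-congˡ (zeroʳ _)) (zeroʳ _)) ⟩
      0# + sumFrom1 n _
        ≈⟨ +-identityˡ _ ⟩
      sumFrom1 n (λ k → fromℕ ((n ℕ.+ 1) C (k ℕ.+ 1)) * (sgn k * powS u k n)) ∎
      where
      u₀≉0 : ¬ (u 0 ≈ 0#)
      u₀≉0 u₀≈0 = 1≉0 (trans (sym u₀≈1) u₀≈0)

  powS-scale : ∀ a f k d → powS (λ e → a * f e) k d ≈ pow a k * powS f k d
  powS-scale a f zero    d = sym (*-identityˡ _)
  powS-scale a f (suc k) d = begin
    mulS af (powS af k) d                    ≈⟨ mulS-congʳ af d (λ e _ → powS-scale a f k e) ⟩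
    mulS af (λ e → pow a k * powS f k e) d   ≈⟨ mulS-scalar a f (pow a k) (powS f k) d ⟩
    pow a (suc k) * powS f (suc k) d         ∎
    where af = λ e → a * f e

  VanishesBelow : ℕ → Series → Set
  VanishesBelow s f = ∀ i → i < s → f i ≈ 0#

  mulS-vanishesBelow : ∀ {a b f g} → VanishesBelow a f → VanishesBelow b g → VanishesBelow (a ℕ.+ b) (mulS f g)
  mulS-vanishesBelow {a} {b} {f} {g} f≈0 g≈0 d d<a+b = sumTo-zero d term
    where
    term : ∀ i → i ≤ d → f i * g (d ∸ i) ≈ 0#
    term i i≤d with i ℕ.<? a
    ... | yes i<a = trans (*-congʳ (f≈0 i i<a)) (zeroˡ _)
    ... | no  i≮a = trans (*-congˡ (g≈0 (d ∸ i) d∸i<b)) (zeroʳ _)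
      where
      a≤i = ℕₚ.≮⇒≥ i≮a
      d∸i<b : d ∸ i < b
      d∸i<b = ℕₚ.≤-<-trans (ℕₚ.∸-monoʳ-≤ d a≤i)
                (≡.subst (d ∸ a <_) (ℕₚ.m+n∸m≡n a b) (ℕₚ.∸-monoˡ-< d<a+b (ℕₚ.≤-trans a≤i i≤d)))

  powS-vanishesBelow : ∀ {s f} → VanishesBelow s f → ∀ k → VanishesBelow (k ℕ.* s) (powS f k)
  powS-vanishesBelow f≈0 zero    i ()
  powS-vanishesBelow f≈0 (suc k) = mulS-vanishesBelow f≈0 (powS-vanishesBelow f≈0 k)

  mulS-shift : ∀ {a b f g} → VanishesBelow a f → VanishesBelow b g →
    ∀ n → mulS f g (n ℕ.+ (a ℕ.+ b)) ≈ mulS (shiftS a f) (shiftS b g) n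
  mulS-shift {a} {b} {f} {g} f≈0 g≈0 n = begin
    sumTo m F
      ≡⟨ ≡.cong (λ t → sumTo t F) m≡a+[b+n] ⟩
    sumTo (a ℕ.+ (b ℕ.+ n)) F
      ≈⟨ sumTo-dropPrefix a (b ℕ.+ n) F (λ i i<a → trans (*-congʳ (f≈0 i i<a)) (zeroˡ _)) ⟩
    sumTo (b ℕ.+ n) (λ j → f (a ℕ.+ j) * g (m ∸ (a ℕ.+ j)))
      ≈⟨ sumTo-cong (b ℕ.+ n) (λ j _ → reflexive (≡.cong (λ t → f (a ℕ.+ j) * g t)
           (≡.trans (≡.cong (_∸ (a ℕ.+ j)) m≡a+[b+n]) (ℕₚ.[m+n]∸[m+o]≡n∸o a (b ℕ.+ n) j)))) ⟩
    sumTo (b ℕ.+ n) G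
      ≈⟨ sumTo-dropSuffix b n G (λ j n<j j≤b+n → trans (*-congˡ (g≈0 _ (≡.subst ((b ℕ.+ n) ∸ j <_)
           (ℕₚ.m+n∸n≡m b n) (ℕₚ.∸-monoʳ-< n<j j≤b+n)))) (zeroʳ _)) ⟩
    sumTo n G
      ≈⟨ sumTo-cong n (λ j j≤n → reflexive (≡.cong₂ (λ x y → f x * g y)
           (ℕₚ.+-comm a j) (≡.trans (ℕₚ.+-∸-assoc b j≤n) (ℕₚ.+-comm b (n ∸ j))))) ⟩
    mulS (shiftS a f) (shiftS b g) n ∎
    where
    m = n ℕ.+ (a ℕ.+ b)
    F = λ i → f i * g (m ∸ i)
    G = λ j → f (a ℕ.+ j) * g ((b ℕ.+ n) ∸ j)
    m≡a+[b+n] : m ≡ a ℕ.+ (b ℕ.+ n)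
    m≡a+[b+n] = ≡.trans (ℕₚ.+-comm n (a ℕ.+ b)) (ℕₚ.+-assoc a b n)

  powS-shift : ∀ {s f} → VanishesBelow s f → ∀ k n → powS f k (n ℕ.+ k ℕ.* s) ≈ powS (shiftS s f) k n
  powS-shift     f≈0 zero    n = reflexive (≡.cong oneS (ℕₚ.+-identityʳ n))
  powS-shift {s} {f} f≈0 (suc k) n = begin
    mulS f (powS f k) (n ℕ.+ (s ℕ.+ k ℕ.* s))          ≈⟨ mulS-shift f≈0 (powS-vanishesBelow f≈0 k) n ⟩
    mulS (shiftS s f) (shiftS (k ℕ.* s) (powS f k)) n  ≈⟨ mulS-congʳ (shiftS s f) n (λ e _ → powS-shift f≈0 k e) ⟩
    mulS (shiftS s f) (powS (shiftS s f) k) n          ∎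

module Transcendence (F K : Field) (e : FieldEmbedding F K) (r : ℕ) {{_ : NonZero r}} (T : Field.Carrier K)
  (transcendental : ∀ cs → Field._≈_ K (Carlitz.evalPoly K r T F (FieldEmbedding.ι e) cs) (Field.0# K)
                         → All (λ c → Field._≈_ F c (Field.0# F)) cs) where
  private module F = Field F
  open Field K hiding (zero)
  open FieldOps K
  open Carlitz K r T
  open FieldEmbedding e using (ι; isRingHom)
  open RingMorphisms.IsRingHomomorphism isRingHom using (0#-homo; 1#-homo; -‿homo)
  open import Relation.Binary.Reasoning.Setoid setoid
  open import Algebra.Properties.Ring ring using (-‿distribʳ-*)
  open import Algebra.Properties.Group F.+-group using (⁻¹-involutive; ε⁻¹≈ε)

  evalPoly-monomial : ∀ j → evalPoly F ι (replicate j F.0# ++ F.1# ∷ []) ≈ pow T j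
  evalPoly-monomial zero    = trans (+-cong 1#-homo (zeroʳ T)) (+-identityʳ 1#)
  evalPoly-monomial (suc j) = trans (+-cong 0#-homo (*-congˡ (evalPoly-monomial j))) (+-identityˡ _)

  T^M-T≉0 : ∀ M → 1 < M → ¬ (pow T M - T ≈ 0#)
  T^M-T≉0 (suc (suc M)) _ T^M-T≈0 with transcendental (F.0# ∷ F.- F.1# ∷ replicate M F.0# ++ F.1# ∷ []) eval≈0
    where
    eval≈0 : evalPoly F ι (F.0# ∷ F.- F.1# ∷ replicate M F.0# ++ F.1# ∷ []) ≈ 0#
    eval≈0 = begin
      ι F.0# + T * (ι (F.- F.1#) + T * evalPoly F ι (replicate M F.0# ++ F.1# ∷ []))
        ≈⟨ +-cong 0#-homo (*-congˡ (+-cong (trans (-‿homo F.1#) (-‿cong 1#-homo)) (*-congˡ (evalPoly-monomial M)))) ⟩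
      0# + T * (- 1# + pow T (suc M))   ≈⟨ +-identityˡ _ ⟩
      T * (- 1# + pow T (suc M))        ≈⟨ distribˡ T _ _ ⟩
      T * - 1# + pow T (suc (suc M))    ≈⟨ +-congʳ (trans (sym (-‿distribʳ-* T 1#)) (-‿cong (*-identityʳ T))) ⟩
      - T + pow T (suc (suc M))         ≈⟨ +-comm _ _ ⟩
      pow T (suc (suc M)) - T           ≈⟨ T^M-T≈0 ⟩
      0#                                ∎
  ... | _ ∷ -1≈0 ∷ _ = F.0≉1 (F.trans (F.sym ε⁻¹≈ε) (F.trans (F.-‿cong (F.sym -1≈0)) (⁻¹-involutive F.1#)))
  T^M-T≉0 (suc zero) (s≤s ())

  brk≉0 : 1 < r → ∀ i → ¬ (brk (suc i) ≈ 0#)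
  brk≉0 1<r i = T^M-T≉0 (r ℕ.^ suc i) (ℕₚ.^-monoʳ-< r 1<r {0} {suc i} (s≤s z≤n))

module CarlitzLemmas (K : Field) (r : ℕ) {{_ : NonZero r}} (T : Field.Carrier K) (1<r : 1 < r)
  (brk≉0 : ∀ i → ¬ (Field._≈_ K (Carlitz.brk K r T (suc i)) (Field.0# K))) where
  open Field K hiding (zero)
  open FieldOps K
  open Carlitz K r T
  open FieldLemmas K
  open FiniteSums K
  open PowerSeries K
  open import Relation.Binary.Reasoning.Setoid setoid
  open import Algebra.Properties.CommutativeSemigroup *-commutativeSemigroup
    using () renaming (interchange to *-interchange)

  D≉0 : ∀ i → ¬ (D i ≈ 0#)
  D≉0 zero    = 1≉0
  D≉0 (suc i) = *-nonzero (brk≉0 i) (pow-nonzero r (D≉0 i))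

  L≉0 : ∀ i → ¬ (L i ≈ 0#)
  L≉0 zero    = 1≉0
  L≉0 (suc i) = *-nonzero (brk≉0 i) (L≉0 i)

  Πaux≉0 : ∀ fuel j n → ¬ (Πaux fuel j n ≈ 0#)
  Πaux≉0 zero        j n = 1≉0
  Πaux≉0 (suc fuel) j n = *-nonzero (pow-nonzero (n ℕ.% r) (D≉0 j)) (Πaux≉0 fuel (suc j) (n ℕ./ r))

  Πc≉0 : ∀ n → ¬ (Πc n ≈ 0#)
  Πc≉0 n = Πaux≉0 n 0 n

  n<r^n : ∀ n → n < r ℕ.^ n
  n<r^n zero    = s≤s z≤n
  n<r^n (suc n) = ℕₚ.≤-<-trans (n<r^n n) (ℕₚ.^-monoʳ-< r 1<r (ℕₚ.n<1+n n))

  logTail-vanishesBelow : ∀ m → VanishesBelow (r ℕ.^ m) (logTail m)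
  logTail-vanishesBelow m d d<r^m = sumTo-zero d λ i _ → term i
    where
    term : ∀ i → (if (m ≤ᵇ i) ∧ does (r ℕ.^ i ℕ.≟ d) then sgn i * (L i ⁻¹) else 0#) ≈ 0#
    term i with m ≤ᵇ i | ℕₚ.≤ᵇ-reflects-≤ m i | r ℕ.^ i ℕ.≡ᵇ d | proof (r ℕ.^ i ℕ.≟ d)
    ... | false | _       | _     | _           = refl
    ... | true  | ofʸ m≤i | false | _           = refl
    ... | true  | ofʸ m≤i | true  | ofʸ r^i≡d =
      ⊥-elim (ℕₚ.<⇒≱ d<r^m (≡.subst (r ℕ.^ m ≤_) r^i≡d (ℕₚ.^-monoʳ-≤ r m≤i)))

  logTail-at : ∀ m → logTail m (r ℕ.^ m) ≈ sgn m * (L m ⁻¹)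
  logTail-at m = trans (sumTo-single (r ℕ.^ m) m _ (ℕₚ.<⇒≤ (n<r^n m)) λ i _ → term i) at-m
    where
    term : ∀ i → ¬ (i ≡ m) → (if (m ≤ᵇ i) ∧ does (r ℕ.^ i ℕ.≟ r ℕ.^ m) then sgn i * (L i ⁻¹) else 0#) ≈ 0#
    term i i≢m with m ≤ᵇ i | ℕₚ.≤ᵇ-reflects-≤ m i | r ℕ.^ i ℕ.≡ᵇ r ℕ.^ m | proof (r ℕ.^ i ℕ.≟ r ℕ.^ m)
    ... | false | _       | _     | _             = refl
    ... | true  | ofʸ m≤i | false | _             = refl
    ... | true  | ofʸ m≤i | true  | ofʸ r^i≡r^m =
      ⊥-elim (ℕₚ.<⇒≢ (ℕₚ.^-monoʳ-< r 1<r (ℕₚ.≤∧≢⇒< m≤i (i≢m ∘ ≡.sym))) (≡.sym r^i≡r^m))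
    at-m : (if (m ≤ᵇ m) ∧ does (r ℕ.^ m ℕ.≟ r ℕ.^ m) then sgn m * (L m ⁻¹) else 0#) ≈ sgn m * (L m ⁻¹)
    at-m with m ≤ᵇ m | ℕₚ.≤ᵇ-reflects-≤ m m | r ℕ.^ m ℕ.≡ᵇ r ℕ.^ m | proof (r ℕ.^ m ℕ.≟ r ℕ.^ m)
    ... | true  | _       | true  | _      = refl
    ... | true  | _       | false | ofⁿ ≢  = ⊥-elim (≢ ≡.refl)
    ... | false | ofⁿ m≰m | _     | _      = ⊥-elim (m≰m ℕₚ.≤-refl)

  -- (log_C - F_{N-1})(x) divided by its lowest term (-1)^N x^{r^N} / L_N
  normalisedLogTail : ℕ → Series
  normalisedLogTail N e = (sgn N * L N) * shiftS (r ℕ.^ N) (logTail N) e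

  module _ (N : ℕ) where
    private
      s = r ℕ.^ N
      c = sgn N * L N ⁻¹

    c≉0 : ¬ (c ≈ 0#)
    c≉0 = *-nonzero (sgn-nonzero N) (⁻¹-nonzero (L≉0 N))

    sgn*L*c≈1 : (sgn N * L N) * c ≈ 1#
    sgn*L*c≈1 = begin
      (sgn N * L N) * (sgn N * L N ⁻¹)   ≈⟨ *-interchange _ _ _ _ ⟩
      (sgn N * sgn N) * (L N * L N ⁻¹)   ≈⟨ *-cong (sgn-square N) (⁻¹-inverse (L N) (L≉0 N)) ⟩
      1# * 1#                            ≈⟨ *-identityˡ 1# ⟩
      1#                                 ∎

    normalisedLogTail₀≈1 : normalisedLogTail N 0 ≈ 1#
    normalisedLogTail₀≈1 = trans (*-congˡ (logTail-at N)) sgn*L*c≈1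

    mulS-shiftedNumer : ∀ v n → mulS (shiftS s (numer N)) v n ≈ c * v n
    mulS-shiftedNumer v n = begin
      mulS (shiftS s (numer N)) v n
        ≈⟨ mulS≈head+sumFrom1 _ v n ⟩
      numer N s * v n + sumFrom1 n (λ i → shiftS s (numer N) i * v (n ∸ i))
        ≈⟨ +-cong (*-congʳ numer-at-s) (sumFrom1-zero n λ i 1≤i _ → trans (*-congʳ (numer-above i 1≤i)) (zeroˡ _)) ⟩
      c * v n + 0#
        ≈⟨ +-identityʳ _ ⟩
      c * v n ∎
      where
      numer-at-s : numer N s ≈ c
      numer-at-s with s ℕ.≡ᵇ s | proof (s ℕ.≟ s)
      ... | true  | _     = refl
      ... | false | ofⁿ ≢ = ⊥-elim (≢ ≡.refl)
      numer-above : ∀ i → 1 ≤ i → numer N (i ℕ.+ s) ≈ 0#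
      numer-above i 1≤i with i ℕ.+ s ℕ.≡ᵇ s | proof (i ℕ.+ s ℕ.≟ s)
      ... | false | _           = refl
      ... | true  | ofʸ i+s≡s = ⊥-elim (ℕₚ.<⇒≢ (ℕₚ.m<n+m s 1≤i) (≡.sym i+s≡s))

    CC≈Πc*invS : ∀ n → CC N n ≈ Πc n * invS (normalisedLogTail N) n
    CC≈Πc*invS n = *-congˡ (begin
      mulS (shiftS s (numer N)) (invS b) n   ≈⟨ mulS-shiftedNumer (invS b) n ⟩
      c * invS b n                           ≈⟨ invS-scale (sgn N * L N) c b sgn*L*c≈1 b₀≉0 n ⟨
      invS (normalisedLogTail N) n           ∎)
      where
      b = shiftS s (logTail N)
      b₀≉0 : ¬ (b 0 ≈ 0#)
      b₀≉0 b₀≈0 = c≉0 (trans (sym (logTail-at N)) b₀≈0)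

    Πc-stirlingC : ∀ m k → Πc k * (Πc m ⁻¹ * stirlingC N m k) ≈ powS (logTail N) k m
    Πc-stirlingC m k = trans (*-congˡ (⁻¹-cancelˡ (Πc≉0 m) _)) (⁻¹-cancelʳ (Πc≉0 k) _)

    stirlingC-summand : ∀ n k →
      sgn k * powS (normalisedLogTail N) k n ≈
      sgn (N ℕ.* k) * (pow (- L N) k * (Πc k * (Πc (n ℕ.+ k ℕ.* s) ⁻¹ * stirlingC N (n ℕ.+ k ℕ.* s) k)))
    stirlingC-summand n k = begin
      sgn k * powS (normalisedLogTail N) k n
        ≈⟨ *-congˡ (powS-scale (sgn N * L N) (shiftS s (logTail N)) k n) ⟩
      sgn k * (pow (sgn N * L N) k * powS (shiftS s (logTail N)) k n)
        ≈⟨ *-congˡ (*-congˡ (powS-shift (logTail-vanishesBelow N) k n)) ⟨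
      sgn k * (pow (sgn N * L N) k * powS (logTail N) k (n ℕ.+ k ℕ.* s))
        ≈⟨ sgn-*-pow N k (L N) _ ⟩
      sgn (N ℕ.* k) * (pow (- L N) k * powS (logTail N) k (n ℕ.+ k ℕ.* s))
        ≈⟨ *-congˡ (*-congˡ (Πc-stirlingC (n ℕ.+ k ℕ.* s) k)) ⟨
      sgn (N ℕ.* k) * (pow (- L N) k * (Πc k * (Πc (n ℕ.+ k ℕ.* s) ⁻¹ * stirlingC N (n ℕ.+ k ℕ.* s) k))) ∎

theorem4 : (r : ℕ) {{_ : NonZero r}} → (∃₂ λ p k → Prime p × r ≡ p ℕ.^ suc k) →
  (F : Field) → HasCard F r →
  (K : Field) → (e : FieldEmbedding F K) → (T : Field.Carrier K) →
  (∀ cs → Field._≈_ K (Carlitz.evalPoly K r T F (FieldEmbedding.ι e) cs) (Field.0# K)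
        → All (λ c → Field._≈_ F c (Field.0# F)) cs) →
  (N n : ℕ) → 1 ≤ N → 1 ≤ n →
  let open Field K
      open FieldOps K
      open Carlitz K r T
  in CC N n ≈ Πc n * sumFrom1 n (λ k →
       fromℕ ((n ℕ.+ 1) C (k ℕ.+ 1)) * (sgn (N ℕ.* k) * (pow (- L N) k * (Πc k *
         ((Πc (n ℕ.+ k ℕ.* r ℕ.^ N) ⁻¹) * stirlingC N (n ℕ.+ k ℕ.* r ℕ.^ N) k)))))
theorem4 r (p , k , p-prime , ≡.refl) F _ K e T transcendental N n _ 1≤n =
  trans (CC≈Πc*invS N n)
        (*-congˡ (trans (invS-coefficient (normalisedLogTail N) (normalisedLogTail₀≈1 N) n 1≤n)
                        (sumFrom1-cong n λ k _ _ → *-congˡ (stirlingC-summand N n k))))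
  where
  open Field K hiding (zero)
  open FiniteSums K
  open PowerSeries K
  1<r = 1<p^[1+k] k p-prime
  open CarlitzLemmas K r T 1<r (Transcendence.brk≉0 F K e r T transcendental 1<r)
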